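{- Let $T$ be an order tree. If $G$ and $G'$ are uniform $T$-graphs, then their end spaces $\Omega(G)$ and $\Omega(G')$ are homeomorphic.
   Context: Ends: a ray is a one-way infinite path; two rays are equivalent if for every finite $X\subset V(G)$ they have tails in the same component of $G-X$; the classes are the ends, forming $\Omega(G)$ with the topology whose basic open sets are $\{\varepsilon: C(X,\varepsilon)=C\}$ for finite $X$ and components $C$ of $G-X$, where $C(X,\varepsilon)$ is the component of $G-X$ containing tails of all rays of $\varepsilon$. An order tree is a poset $(T,\le)$ with a unique minimal element in which every $\lceil t\rceil=\{t'\le t\}$ is well-ordered; $\mathring{\lceil t\rceil}=\lceil t\rceil\setminus\{t\}$. A point is a limit if it has no immediate predecessor. A graph $G$ is a $T$-graph if $V(G)=T$, endvertices of edges are comparable in $T$, and for each $t$ its neighbours below $t$ are cofinal in $\mathring{\lceil t\rceil}$. It is uniform if for every limit $t$ there is a finite $S_t\subset\mathring{\lceil t\rceil}$ such that every $t'>t$ has all its neighbours $s$ with $s<t$ in $S_t$. -}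

module Defs where

open import Level using (0ℓ) renaming (suc to lsuc)
open import Data.Nat using (ℕ; suc; _+_)
open import Data.Product using (Σ; ∃; ∃-syntax; _×_; _,_)
open import Data.Sum using (_⊎_)
open import Data.List using (List)
open import Data.List.Membership.Propositional using (_∈_; _∉_)
open import Data.List.Relation.Unary.All using (All)
open import Relation.Nullary using (¬_)
open import Relation.Binary.PropositionalEquality using (_≡_; _≢_)
open import Relation.Binary.Construct.Closure.ReflexiveTransitive using (Star)
open import Function.Definitions using (Injective)

record OrderTree : Set₁ where
  field
    Carrier : Set
    _≤_     : Carrier → Carrier → Set
    ≤-refl    : ∀ {a} → a ≤ a
    ≤-trans   : ∀ {a b c} → a ≤ b → b ≤ c → a ≤ c
    ≤-antisym : ∀ {a b} → a ≤ b → b ≤ a → a ≡ b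
    root       : Carrier
    root-minimal : ∀ {t} → t ≤ root → t ≡ root
    root-unique  : ∀ r → (∀ {t} → t ≤ r → t ≡ r) → r ≡ root
    -- every down-closure ⌈t⌉ = {t' ≤ t} is well-ordered:
    -- it is totally ordered ...
    down-total : ∀ {t a b} → a ≤ t → b ≤ t → a ≤ b ⊎ b ≤ a
    down-wf : ∀ t (P : Carrier → Set) → (∃[ s ] (s ≤ t × P s)) →
              ∃[ m ] (m ≤ t × P m × (∀ s → s ≤ t → P s → m ≤ s))

  _<_ : Carrier → Carrier → Set
  a < b = a ≤ b × a ≢ b

  IsLimit : Carrier → Set
  IsLimit t = ¬ (∃[ s ] (s < t × (∀ u → u < t → u ≤ s)))

record Graph (V : Set) : Set₁ where
  field
    E       : V → V → Set
    E-sym   : ∀ {a b} → E a b → E b a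
    E-irrefl : ∀ {a} → ¬ E a a

module _ {V : Set} (G : Graph V) where
  open Graph G

  -- finite vertex sets are lists
  -- edge of G - X
  EdgeAvoid : List V → V → V → Set
  EdgeAvoid X a b = E a b × a ∉ X × b ∉ X

  Conn : List V → V → V → Set
  Conn X a b = a ∉ X × Star (EdgeAvoid X) a b

  record Ray : Set where
    constructor ray
    field
      seq  : ℕ → V
      inj  : Injective _≡_ _≡_ seq
      step : ∀ n → E (seq n) (seq (suc n))

  open Ray

  -- the ray r has a tail in the component of G - X containing v,
  -- i.e. C(X, [r]) is the component of v
  InComp : List V → V → Ray → Set
  InComp X v r = ∃[ n ] ((∀ k → seq r (n + k) ∉ X) × Conn X v (seq r n))

  _≈ᵉ_ : Ray → Ray → Set
  r ≈ᵉ r' = ∀ (X : List V) → ∃[ v ] (InComp X v r × InComp X v r')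

  -- subsets of Ω(G): predicates on rays invariant under equivalence
  Respects : (Ray → Set) → Set
  Respects U = ∀ {r r'} → r ≈ᵉ r' → U r → U r'

  -- open sets of Ω(G): unions of basic open sets
  -- {ε : C(X,ε) = C}, where C is the component of G - X containing v ∉ X
  IsOpen : (Ray → Set) → Set
  IsOpen U = Respects U ×
    (∀ r → U r → ∃[ X ] ∃[ v ] (InComp X v r × (∀ r' → InComp X v r' → U r')))

Continuous : {V V' : Set} (G : Graph V) (G' : Graph V') → (Ray G → Ray G') → Set₁
Continuous G G' f = ∀ (U : Ray G' → Set) → IsOpen G' U → IsOpen G (λ r → U (f r))

module _ {V V' : Set} (G : Graph V) (G' : Graph V') where

  record EndsHomeomorphic : Set₁ where
    field
      to      : Ray G → Ray G'
      from    : Ray G' → Ray G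
      to-cong   : ∀ {r s} → _≈ᵉ_ G r s → _≈ᵉ_ G' (to r) (to s)
      from-cong : ∀ {r s} → _≈ᵉ_ G' r s → _≈ᵉ_ G (from r) (from s)
      from-to : ∀ r → _≈ᵉ_ G (from (to r)) r
      to-from : ∀ r → _≈ᵉ_ G' (to (from r)) r
      to-cont   : Continuous G G' to
      from-cont : Continuous G' G from

module _ (T : OrderTree) where
  open OrderTree T

  record IsTGraph (G : Graph Carrier) : Set where
    open Graph G
    field
      comparable : ∀ {a b} → E a b → a ≤ b ⊎ b ≤ a
      cofinal : ∀ t s → s < t → ∃[ u ] (s ≤ u × u < t × E u t)

  IsUniform : Graph Carrier → Set
  IsUniform G = ∀ t → IsLimit t →
    ∃[ S ] (All (_< t) S ×
      (∀ t' s → t < t' → Graph.E G s t' → s < t → s ∈ S))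

module Submission where

-- A ray r of a T-graph determines the chain Below r of points of T that r eventually lies
-- strictly above. In a uniform T-graph every point u has a finite separator, meeting every
-- edge from the strict up-set of u to its complement (by induction along T, using the sets
-- S_t at limits). Through these separators two rays are equivalent iff their chains agree, and
-- the basic open sets of the end space are exactly the sets of rays whose chain contains a
-- given t and misses a given finite Y. So the end space is determined by the set of chains
-- that occur, and that set is the same for all T-graphs: such a chain has a cofinal strictly
-- increasing sequence, and every strictly increasing sequence of T is traced by a ray in any
-- T-graph, made of up-paths between consecutive terms.

open import Defs
open import Level using (0ℓ; lift; lower)
open import Axiom.ExcludedMiddle using (ExcludedMiddle)
open import Data.Nat using (ℕ; zero; suc; _+_; _∸_; _⊔_; _≤′_; ≤′-refl; ≤′-step)
  renaming (_≤_ to _≤ℕ_; _<_ to _<ℕ_)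
open import Data.Nat.Properties
  using ( m≤m+n; m≤n+m; m≤m⊔n; m≤n⊔m; m∸n+n≡m; m+[n∸m]≡n; +-identityʳ; +-suc; n≤1+n
        ; <-cmp; ≤⇒≤′; ≤′⇒≤)
  renaming (≤-refl to ≤ℕ-refl; ≤-trans to ≤ℕ-trans; <-irrefl to <ℕ-irrefl)
open import Data.Nat.GeneralisedArithmetic using (fold; fold-+)
open import Data.Product using (Σ; Σ-syntax; ∃-syntax; _×_; _,_; proj₁; proj₂)
open import Data.Sum using (_⊎_; inj₁; inj₂)
import Data.Sum as Sum
open import Data.List using (List; []; _∷_; _++_; concatMap)
open import Data.List.Membership.Propositional using (_∈_; _∉_)
open import Data.List.Membership.Propositional.Properties using (∈-++⁺ʳ; ∈-concatMap⁺)
open import Data.List.Relation.Binary.Subset.Propositional using (_⊆_)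
open import Data.List.Relation.Binary.Subset.Propositional.Properties using (xs⊆xs++ys)
open import Data.List.Relation.Unary.All as All using (All; []; _∷_)
open import Data.List.Relation.Unary.Any as Any using (here; there)
open import Data.Empty using (⊥-elim)
open import Data.Unit using (⊤; tt)
open import Function using (_∘_; id)
open import Relation.Nullary using (¬_; Dec; yes; no)
open import Relation.Nullary.Decidable using (map′; decidable-stable)
open import Relation.Unary using (_≐_; ∁)
open import Relation.Unary.Properties using (≐-sym; ≐-trans)
open import Relation.Binary using (Rel; _Respectsˡ_; _Respectsʳ_; tri<; tri≈; tri>)
open import Relation.Binary.PropositionalEquality using (_≡_; _≢_; refl; sym; trans; cong; subst)
open import Relation.Binary.Construct.Closure.ReflexiveTransitive
  using (Star; ε; _◅_; _◅◅_; reverse)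
open import Relation.Binary.Construct.Closure.Transitive using (TransClosure; [_]; _∷_; _∷ʳ_)
import Relation.Binary.Construct.NonStrictToStrict as NonStrictToStrict

Eventually : (ℕ → Set) → Set
Eventually P = ∃[ m ] (∀ n → m ≤ℕ n → P n)

eventually-× : ∀ {P Q : ℕ → Set} → Eventually P → Eventually Q → Eventually (λ n → P n × Q n)
eventually-× (m₁ , p) (m₂ , q) =
  m₁ ⊔ m₂ , λ n m≤n → p n (≤ℕ-trans (m≤m⊔n m₁ m₂) m≤n) , q n (≤ℕ-trans (m≤n⊔m m₁ m₂) m≤n)

eventually-map : ∀ {P Q : ℕ → Set} → (∀ {n} → P n → Q n) → Eventually P → Eventually Q
eventually-map f (m , p) = m , λ n m≤n → f (p n m≤n)

tail⇒eventually : ∀ {P : ℕ → Set} m → (∀ k → P (m + k)) → Eventually P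
tail⇒eventually {P} m p = m , λ n m≤n → subst P (m+[n∸m]≡n m≤n) (p (n ∸ m))

eventually⇒tail : ∀ {P : ℕ → Set} ((m , p) : Eventually P) → ∀ {n} → m ≤ℕ n → ∀ k → P (n + k)
eventually⇒tail (m , p) {n} m≤n k = p (n + k) (≤ℕ-trans m≤n (m≤m+n n k))

module Concatenation {A : Set} {R : Rel A 0ℓ}
  (a : ℕ → A) (segment-path : ∀ i → TransClosure R (a i) (a (suc i))) where

  -- the index of the current segment, the current vertex, and what is left of the segment
  Position : Set
  Position = Σ[ i ∈ ℕ ] Σ[ x ∈ A ] TransClosure R x (a (suc i))

  advance : Position → Position
  advance (i , _ , [ _ ]) = suc i , a (suc i) , segment-path (suc i)
  advance (i , _ , _∷_ {y = y} _ rest) = i , y , rest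

  position : ℕ → Position
  position = fold (0 , a 0 , segment-path 0) advance

  segment : ℕ → ℕ
  segment n = proj₁ (position n)

  walk : ℕ → A
  walk n = proj₁ (proj₂ (position n))

  walk-remaining : ∀ n → TransClosure R (walk n) (a (suc (segment n)))
  walk-remaining n = proj₂ (proj₂ (position n))

  walk-step : ∀ n → R (walk n) (walk (suc n))
  walk-step n = first-edge (position n)
    where
    first-edge : (p : Position) → R (proj₁ (proj₂ p)) (proj₁ (proj₂ (advance p)))
    first-edge (_ , _ , [ e ]) = e
    first-edge (_ , _ , e ∷ _) = e

  walk-path : ∀ n k → Star R (walk n) (walk (k + n))
  walk-path n zero = ε
  walk-path n (suc k) = walk-path n k ◅◅ (walk-step (k + n) ◅ ε)

  walk-traversed : ∀ n → Star R (a (segment n)) (walk n)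
  walk-traversed zero = ε
  walk-traversed (suc n) = advance-traversed (position n) (walk-traversed n)
    where
    advance-traversed : (p : Position) → Star R (a (proj₁ p)) (proj₁ (proj₂ p)) →
                        Star R (a (proj₁ (advance p))) (proj₁ (proj₂ (advance p)))
    advance-traversed (_ , _ , [ _ ]) _ = ε
    advance-traversed (_ , _ , e ∷ _) p = p ◅◅ (e ◅ ε)

  advance-finishes-segment : ∀ i x (rest : TransClosure R x (a (suc i))) →
                             ∃[ d ] proj₁ (fold (i , x , rest) advance d) ≡ suc i
  advance-finishes-segment i x [ _ ] = 1 , refl
  advance-finishes-segment i x (e ∷ rest) =
    let (d , finished) = advance-finishes-segment i _ rest
    in d + 1 , trans (cong proj₁ (fold-+ (i , x , e ∷ rest) advance d)) finished

  segment-surjective : ∀ i → ∃[ n ] segment n ≡ i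
  segment-surjective zero = 0 , refl
  segment-surjective (suc i) =
    let (n , reached) = segment-surjective i
        (d , finished) = advance-finishes-segment _ _ (walk-remaining n)
    in d + n , trans (cong proj₁ (fold-+ _ advance d)) (trans finished (cong suc reached))

module OrderTreeProperties (T : OrderTree) where
  open OrderTree T

  private
    module Strict = NonStrictToStrict _≡_ _≤_

    ≤-respˡ-≡ : _≤_ Respectsˡ _≡_
    ≤-respˡ-≡ refl p = p

    ≤-respʳ-≡ : _≤_ Respectsʳ _≡_
    ≤-respʳ-≡ refl p = p

  <-irrefl : ∀ {a} → ¬ a < a
  <-irrefl = Strict.<-irrefl refl

  ≤-<-trans : ∀ {a b c} → a ≤ b → b < c → a < c
  ≤-<-trans = Strict.≤-<-trans ≤-trans ≤-antisym ≤-respˡ-≡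

  <-≤-trans : ∀ {a b c} → a < b → b ≤ c → a < c
  <-≤-trans = Strict.<-≤-trans sym ≤-trans ≤-antisym ≤-respʳ-≡

  <-trans : ∀ {a b c} → a < b → b < c → a < c
  <-trans a<b b<c = <-≤-trans a<b (proj₁ b<c)

  root-≤ : ∀ t → root ≤ t
  root-≤ t =
    let (m , m≤t , _ , least) = down-wf t (λ _ → ⊤) (t , ≤-refl , tt)
        m-minimal : ∀ {s} → s ≤ m → s ≡ m
        m-minimal s≤m = ≤-antisym s≤m (least _ (≤-trans s≤m m≤t) tt)
    in subst (_≤ t) (root-unique m m-minimal) m≤t

  Below : (ℕ → Carrier) → Carrier → Set
  Below f t = Eventually (λ n → t < f n)

  Below-≤-closed : ∀ f {a b} → a ≤ b → Below f b → Below f a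
  Below-≤-closed f a≤b = eventually-map (≤-<-trans a≤b)

  Below-total : ∀ f {a b} → Below f a → Below f b → a ≤ b ⊎ b ≤ a
  Below-total f fa fb =
    let (m , both) = eventually-× fa fb
        (a<fm , b<fm) = both m ≤ℕ-refl
    in down-total (proj₁ a<fm) (proj₁ b<fm)

  Below-join : ∀ f {a b} → Below f a → Below f b → ∃[ c ] (Below f c × a ≤ c × b ≤ c)
  Below-join f {a} {b} fa fb with Below-total f fa fb
  ... | inj₁ a≤b = b , fb , a≤b , ≤-refl
  ... | inj₂ b≤a = a , fa , ≤-refl , b≤a

  BranchNbhd : Carrier → List Carrier → (ℕ → Carrier) → Set
  BranchNbhd t Y f = Below f t × All (∁ (Below f)) Y

  BranchNbhd-cong : ∀ {f g t Y} → Below f ≐ Below g → BranchNbhd t Y f → BranchNbhd t Y g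
  BranchNbhd-cong (f⊆g , g⊆f) (ft , ¬fY) = f⊆g ft , All.map (λ ¬fy gy → ¬fy (g⊆f gy)) ¬fY

  Below-preserving : {G G′ : Graph Carrier} → (Ray G → Ray G′) → Set
  Below-preserving φ = ∀ r → Below (Ray.seq (φ r)) ≐ Below (Ray.seq r)

module Classical (em : ExcludedMiddle (Level.suc 0ℓ)) where

  dec : (P : Set) → Dec P
  dec P = map′ lower lift em

  by-contradiction : {P : Set} → ¬ ¬ P → P
  by-contradiction {P} = decidable-stable (dec P)

  module RayProperties {V : Set} (G : Graph V) where
    open Graph G
    open Ray

    ≈ᵉ-sym : ∀ {r s} → _≈ᵉ_ G r s → _≈ᵉ_ G s r
    ≈ᵉ-sym r≈s X = let (v , r∈ , s∈) = r≈s X in v , s∈ , r∈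

    reverse-avoiding : ∀ {X a b} → Star (EdgeAvoid G X) a b → Star (EdgeAvoid G X) b a
    reverse-avoiding = reverse λ (e , a∉X , b∉X) → E-sym e , b∉X , a∉X

    ray-eventually-≢ : (r : Ray G) (x : V) → Eventually (λ n → seq r n ≢ x)
    ray-eventually-≢ r x with dec (∃[ n ] seq r n ≡ x)
    ... | yes (n , rn≡x) = suc n , λ m n<m rm≡x →
      <ℕ-irrefl refl (subst (n <ℕ_) (inj r (trans rm≡x (sym rn≡x))) n<m)
    ... | no never = 0 , λ n _ rn≡x → never (n , rn≡x)

    ray-eventually-∉ : (r : Ray G) (X : List V) → Eventually (λ n → seq r n ∉ X)
    ray-eventually-∉ r [] = 0 , λ _ _ ()
    ray-eventually-∉ r (x ∷ X) =
      eventually-map ∉-∷ (eventually-× (ray-eventually-≢ r x) (ray-eventually-∉ r X))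
      where
      ∉-∷ : ∀ {y} → y ≢ x × y ∉ X → y ∉ x ∷ X
      ∉-∷ (y≢x , _) (here y≡x) = y≢x y≡x
      ∉-∷ (_ , y∉X) (there y∈X) = y∉X y∈X

    ray-tail-path : ∀ {Z} (r : Ray G) n → (∀ k → seq r (n + k) ∉ Z) →
                    ∀ k → Star (EdgeAvoid G Z) (seq r n) (seq r (n + k))
    ray-tail-path {Z} r n r∉Z zero =
      subst (Star (EdgeAvoid G Z) (seq r n) ∘ seq r) (sym (+-identityʳ n)) ε
    ray-tail-path {Z} r n r∉Z (suc k) = ray-tail-path r n r∉Z k ◅◅ (edge ◅ ε)
      where
      edge : EdgeAvoid G Z (seq r (n + k)) (seq r (n + suc k))
      edge = subst (EdgeAvoid G Z (seq r (n + k)) ∘ seq r) (sym (+-suc n k))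
               (step r (n + k) , r∉Z k , subst (λ j → seq r j ∉ Z) (+-suc n k) (r∉Z (suc k)))

    ray-InComp : ∀ X (r : Ray G) → ∃[ v ] InComp G X v r
    ray-InComp X r =
      let (m , r∉X) = ray-eventually-∉ r X
      in seq r m , m , eventually⇒tail (m , r∉X) ≤ℕ-refl , r∉X m ≤ℕ-refl , ε

  module TGraph (T : OrderTree) (G : Graph (OrderTree.Carrier T)) (isT : IsTGraph T G) where
    open OrderTree T
    open OrderTreeProperties T
    open Graph G
    open IsTGraph isT
    open RayProperties G public
    open Ray using (seq)

    <-induction : (P : Carrier → Set) → (∀ t → (∀ s → s < t → P s) → P t) → ∀ t → P t
    <-induction P step t = by-contradiction λ ¬Pt →
      let (m , m≤t , ¬Pm , least) = down-wf t (¬_ ∘ P) (t , ≤-refl , ¬Pt)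
      in ¬Pm (step m λ s s<m → by-contradiction λ ¬Ps →
           <-irrefl (≤-<-trans (least s (≤-trans (proj₁ s<m) m≤t) ¬Ps) s<m))

    leaves-up-set⇒≤ : ∀ {c x y} → c ≤ x → E x y → ¬ c ≤ y → y ≤ c
    leaves-up-set⇒≤ c≤x e c≰y with comparable e
    ... | inj₁ x≤y = ⊥-elim (c≰y (≤-trans c≤x x≤y))
    ... | inj₂ y≤x with down-total c≤x y≤x
    ...   | inj₁ c≤y = ⊥-elim (c≰y c≤y)
    ...   | inj₂ y≤c = y≤c

    leaves-strict-up-set⇒≤ : ∀ {u x y} → u < x → E x y → ¬ u < y → y ≤ u
    leaves-strict-up-set⇒≤ {u} {x} {y} u<x e u≮y with dec (u ≤ y)
    ... | yes u≤y = subst (_≤ u) (by-contradiction λ u≢y → u≮y (u≤y , u≢y)) ≤-refl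
    ... | no u≰y = leaves-up-set⇒≤ (proj₁ u<x) e u≰y

    UpEdge : Rel Carrier 0ℓ
    UpEdge a b = E a b × a < b

    Star-UpEdge⇒≤ : ∀ {a b} → Star UpEdge a b → a ≤ b
    Star-UpEdge⇒≤ ε = ≤-refl
    Star-UpEdge⇒≤ ((_ , a<x) ◅ p) = ≤-trans (proj₁ a<x) (Star-UpEdge⇒≤ p)

    TransClosure-UpEdge⇒< : ∀ {a b} → TransClosure UpEdge a b → a < b
    TransClosure-UpEdge⇒< [ _ , a<b ] = a<b
    TransClosure-UpEdge⇒< ((_ , a<x) ∷ p) = <-trans a<x (TransClosure-UpEdge⇒< p)

    up-path : ∀ {w a} → w < a → TransClosure UpEdge w a
    up-path {w} {a} = <-induction (λ a → ∀ {w} → w < a → TransClosure UpEdge w a) step a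
      where
      step : ∀ a → (∀ s → s < a → ∀ {w} → w < s → TransClosure UpEdge w s) →
             ∀ {w} → w < a → TransClosure UpEdge w a
      step a ih {w} w<a with cofinal a w w<a
      ... | u , w≤u , u<a , e with dec (w ≡ u)
      ...   | yes refl = [ e , u<a ]
      ...   | no w≢u = ih u u<a (w≤u , w≢u) ∷ʳ (e , u<a)

    interval-path : ∀ {X w a} → w < a → (∀ y → w ≤ y → y ≤ a → y ∉ X) → Star (EdgeAvoid G X) w a
    interval-path w<a = along (up-path w<a)
      where
      along : ∀ {X w a} → TransClosure UpEdge w a → (∀ y → w ≤ y → y ≤ a → y ∉ X) →
              Star (EdgeAvoid G X) w a
      along [ e , w<a ] outside =
        (e , outside _ ≤-refl (proj₁ w<a) , outside _ (proj₁ w<a) ≤-refl) ◅ ε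
      along ((e , w<x) ∷ p) outside =
        (e , outside _ ≤-refl (proj₁ (TransClosure-UpEdge⇒< ((e , w<x) ∷ p)))
           , outside _ (proj₁ w<x) (proj₁ (TransClosure-UpEdge⇒< p)))
        ◅ along p (λ y x≤y y≤a → outside y (≤-trans (proj₁ w<x) x≤y) y≤a)

    Below-root : ∀ r → Below (seq r) root
    Below-root r = eventually-map (λ rn≢root → root-≤ _ , rn≢root ∘ sym) (ray-eventually-≢ r root)

    -- The least b ≤ r m with P is never left by the tail of r: an edge leaving the up-set of b
    -- would end strictly below b at a vertex still satisfying P.
    Below-of-tail : ∀ (r : Ray G) m (P : Carrier → Set) → (∀ n → m ≤ℕ n → P (seq r n)) →
                    ∃[ b ] (P b × Below (seq r) b)
    Below-of-tail r m P tail-P with down-wf (seq r m) P (seq r m , ≤-refl , tail-P m ≤ℕ-refl)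
    ... | b , b≤rm , Pb , least =
      b , Pb , eventually-map (λ (b≤rn , rn≢b) → b≤rn , rn≢b ∘ sym)
                              (eventually-× (m , λ n m≤n → stays (≤⇒≤′ m≤n)) (ray-eventually-≢ r b))
      where
      stays : ∀ {n} → m ≤′ n → b ≤ seq r n
      stays ≤′-refl = b≤rm
      stays {suc n} (≤′-step m≤n) = by-contradiction λ b≰rn+1 →
        let rn+1≤b = leaves-up-set⇒≤ (stays m≤n) (Ray.step r n) b≰rn+1
        in b≰rn+1 (least _ (≤-trans rn+1≤b b≤rm) (tail-P (suc n) (≤ℕ-trans (≤′⇒≤ m≤n) (n≤1+n n))))

    Below-unbounded : ∀ (r : Ray G) {t} → Below (seq r) t → ∃[ t′ ] (t < t′ × Below (seq r) t′)
    Below-unbounded r (m , t<r) = Below-of-tail r m (_ <_) t<r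

    Below-bounds-tail : ∀ (r : Ray G) n →
      ∃[ c ] (Below (seq r) c × (∀ t → (∀ k → n ≤ℕ k → t < seq r k) → t < c))
    Below-bounds-tail r n = by-contradiction λ no-bound →
      let (b , b-bounds , b-below) = Below-of-tail r n (λ b → ∀ t → Below (seq r) t → t < b)
                                       (λ k n≤k t rt → below-tail no-bound t rt k n≤k)
      in <-irrefl (b-bounds b b-below)
      where
      TailLowerBound : Carrier → Set
      TailLowerBound t = ∀ k → n ≤ℕ k → t < seq r k

      -- A c that is not a tail lower bound would bound them all, as Below r is a chain.
      below-tail : ¬ (∃[ c ] (Below (seq r) c × (∀ t → TailLowerBound t → t < c))) →
                   ∀ c → Below (seq r) c → TailLowerBound c
      below-tail no-bound c rc = by-contradiction λ ¬c-bound → no-bound (c , rc , λ t t-bound →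
        case-total (Below-total (seq r) (n , t-bound) rc) t-bound ¬c-bound)
        where
        case-total : ∀ {t} → t ≤ c ⊎ c ≤ t → TailLowerBound t → ¬ TailLowerBound c → t < c
        case-total (inj₁ t≤c) t-bound ¬c-bound = t≤c , λ { refl → ¬c-bound t-bound }
        case-total (inj₂ c≤t) t-bound ¬c-bound =
          ⊥-elim (¬c-bound λ k n≤k → ≤-<-trans c≤t (t-bound k n≤k))

    Below-cofinal-sequence : (r : Ray G) →
      ∃[ t ] ((∀ i → t i < t (suc i)) × Below (seq r) ≐ (λ u → ∃[ i ] u < t i))
    Below-cofinal-sequence r = t , t-increasing , Below⊆ , Below⊇
      where
      c : ℕ → Carrier
      c n = proj₁ (Below-bounds-tail r n)

      raise : ∀ i (a : Σ Carrier (Below (seq r))) →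
              Σ[ a′ ∈ Σ Carrier (Below (seq r)) ] (proj₁ a < proj₁ a′ × c i < proj₁ a′)
      raise i (a , ra) =
        let (m , rm , a≤m , cᵢ≤m) = Below-join (seq r) ra (proj₁ (proj₂ (Below-bounds-tail r i)))
            (a′ , m<a′ , ra′) = Below-unbounded r rm
        in (a′ , ra′) , ≤-<-trans a≤m m<a′ , ≤-<-trans cᵢ≤m m<a′

      chain : ℕ → Σ Carrier (Below (seq r))
      chain zero = root , Below-root r
      chain (suc i) = proj₁ (raise i (chain i))

      t : ℕ → Carrier
      t i = proj₁ (chain i)

      t-increasing : ∀ i → t i < t (suc i)
      t-increasing i = proj₁ (proj₂ (raise i (chain i)))

      Below⊆ : ∀ {u} → Below (seq r) u → ∃[ i ] u < t i
      Below⊆ (n , u<r) = suc n , <-trans (proj₂ (proj₂ (Below-bounds-tail r n)) _ u<r)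
                                          (proj₂ (proj₂ (raise n (chain n))))

      Below⊇ : ∀ {u} → ∃[ i ] u < t i → Below (seq r) u
      Below⊇ (i , u<tᵢ) = Below-≤-closed (seq r) (proj₁ u<tᵢ) (proj₂ (chain i))

    ray-through : (t : ℕ → Carrier) → (∀ i → t i < t (suc i)) →
                  Σ[ R ∈ Ray G ] Below (seq R) ≐ (λ u → ∃[ i ] u < t i)
    ray-through t t-increasing = ray walk walk-injective (proj₁ ∘ walk-step) , Below⊆ , Below⊇
      where
      open Concatenation t (λ i → up-path (t-increasing i))

      walk-≤ : ∀ {n m} → n ≤ℕ m → walk n ≤ walk m
      walk-≤ {n} {m} n≤m =
        subst (λ j → walk n ≤ walk j) (m∸n+n≡m n≤m) (Star-UpEdge⇒≤ (walk-path n (m ∸ n)))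

      walk-< : ∀ {n m} → n <ℕ m → walk n < walk m
      walk-< {n} n<m = <-≤-trans (proj₂ (walk-step n)) (walk-≤ n<m)

      walk-injective : ∀ {n m} → walk n ≡ walk m → n ≡ m
      walk-injective {n} {m} wn≡wm with <-cmp n m
      ... | tri< n<m _ _ = ⊥-elim (<-irrefl (subst (walk n <_) (sym wn≡wm) (walk-< n<m)))
      ... | tri≈ _ n≡m _ = n≡m
      ... | tri> _ _ m<n = ⊥-elim (<-irrefl (subst (walk m <_) wn≡wm (walk-< m<n)))

      Below⊆ : ∀ {u} → Below walk u → ∃[ i ] u < t i
      Below⊆ (m , u<walk) = suc (segment m) , <-trans (u<walk m ≤ℕ-refl)
                                                      (TransClosure-UpEdge⇒< (walk-remaining m))

      Below⊇ : ∀ {u} → ∃[ i ] u < t i → Below walk u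
      Below⊇ {u} (i , u<tᵢ) =
        let (n , segment≡i) = segment-surjective i
            tᵢ≤walk = subst (λ j → t j ≤ walk n) segment≡i (Star-UpEdge⇒≤ (walk-traversed n))
        in n , λ m n≤m → <-≤-trans u<tᵢ (≤-trans tᵢ≤walk (walk-≤ n≤m))

    Screens : Carrier → List Carrier → List Carrier → Set
    Screens b Y X = ∀ {x} → x ∈ X → ¬ b ≤ x ⊎ x ∈ Y

    screen : (r : Ray G) (X : List Carrier) → ∃[ b ] ∃[ Y ] (BranchNbhd b Y (seq r) × Screens b Y X)
    screen r [] = root , [] , (Below-root r , []) , λ ()
    screen r (x ∷ X) with screen r X | dec (Below (seq r) x)
    ... | b , Y , (rb , ¬rY) , screens | yes rx =
      let (x′ , x<x′ , rx′) = Below-unbounded r rx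
          (m , rm , b≤m , x′≤m) = Below-join (seq r) rb rx′
      in m , Y , (rm , ¬rY) , λ
         { (here refl) → inj₁ λ m≤x → <-irrefl (<-≤-trans x<x′ (≤-trans x′≤m m≤x))
         ; (there x∈X) → Sum.map (λ b≰x m≤x → b≰x (≤-trans b≤m m≤x)) id (screens x∈X) }
    ... | b , Y , (rb , ¬rY) , screens | no ¬rx =
      b , x ∷ Y , (rb , ¬rx ∷ ¬rY) , λ
         { (here refl) → inj₂ (here refl)
         ; (there x∈X) → Sum.map id there (screens x∈X) }

  module UniformTGraph (T : OrderTree) (G : Graph (OrderTree.Carrier T))
                       (isT : IsTGraph T G) (unif : IsUniform T G) where
    open OrderTree T
    open OrderTreeProperties T
    open Graph G
    open TGraph T G isT
    open Ray using (seq)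

    Separates : Carrier → List Carrier → Set
    Separates u X = ∀ {x y} → u < x → E x y → ¬ u < y → y ∈ X

    Separates-mono : ∀ {u X Z} → X ⊆ Z → Separates u X → Separates u Z
    Separates-mono X⊆Z sep u<x e u≮y = X⊆Z (sep u<x e u≮y)

    separator : ∀ u → ∃[ X ] Separates u X
    separator = <-induction (λ u → ∃[ X ] Separates u X) step
      where
      catch-below : ∀ {u Z} → (∀ {x y} → u < x → E x y → y < u → y ∈ Z) → Separates u (u ∷ Z)
      catch-below {u} catch {y = y} u<x e u≮y with dec (y ≡ u)
      ... | yes y≡u = here y≡u
      ... | no y≢u = there (catch u<x e (leaves-strict-up-set⇒≤ u<x e u≮y , y≢u))

      step : ∀ u → (∀ s → s < u → ∃[ X ] Separates s X) → ∃[ X ] Separates u X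
      step u ih with dec (IsLimit u)
      ... | yes limit =
        let (S , _ , S-catches) = unif u limit
        in u ∷ S , catch-below λ u<x e y<u → S-catches _ _ u<x (E-sym e) y<u
      ... | no ¬limit =
        let (p , p<u , p-maximal) = by-contradiction ¬limit
            (X , p-separated) = ih p p<u
        in u ∷ X , catch-below λ u<x e y<u →
             p-separated (<-trans p<u u<x) e λ p<y → <-irrefl (<-≤-trans p<y (p-maximal _ y<u))

    sep : Carrier → List Carrier
    sep u = proj₁ (separator u)

    sep-separates : ∀ u → Separates u (sep u)
    sep-separates u = proj₂ (separator u)

    separated-path-stays-above : ∀ {u Z a b} → Separates u Z → Star (EdgeAvoid G Z) a b →
                                 u < a → u < b
    separated-path-stays-above separates ε u<a = u<a
    separated-path-stays-above separates ((e , _ , x∉Z) ◅ p) u<a =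
      separated-path-stays-above separates p (by-contradiction λ u≮x → x∉Z (separates u<a e u≮x))

    Below-transfer : ∀ {u X v} (r s : Ray G) → Separates u X → InComp G X v r → InComp G X v s →
                     Below (seq r) u → Below (seq s) u
    Below-transfer {u} {X} r s separates (n , r∉X , _ , v~rn) (m , s∉X , _ , v~sm) (q , u<r) =
      tail⇒eventually m λ k → separated-path-stays-above separates (ray-tail-path s m s∉X k) u<sm
      where
      rn+q~sm : Star (EdgeAvoid G X) (seq r (n + q)) (seq s m)
      rn+q~sm = reverse-avoiding (v~rn ◅◅ ray-tail-path r n r∉X q) ◅◅ v~sm

      u<sm : u < seq s m
      u<sm = separated-path-stays-above separates rn+q~sm (u<r (n + q) (m≤n+m q n))

    ≈ᵉ⇒Below⊆ : ∀ {r s} → _≈ᵉ_ G r s → ∀ {t} → Below (seq r) t → Below (seq s) t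
    ≈ᵉ⇒Below⊆ {r} {s} r≈s {t} =
      let (_ , r∈ , s∈) = r≈s (sep t) in Below-transfer r s (sep-separates t) r∈ s∈

    ≈ᵉ⇒Below≐ : ∀ {r s} → _≈ᵉ_ G r s → Below (seq r) ≐ Below (seq s)
    ≈ᵉ⇒Below≐ {r} {s} r≈s = ≈ᵉ⇒Below⊆ {r} {s} r≈s , ≈ᵉ⇒Below⊆ {s} {r} (≈ᵉ-sym {r} {s} r≈s)

    BranchNbhd⇒InComp : ∀ {t Y} (r : Ray G) → BranchNbhd t Y (seq r) →
      ∃[ X ] ∃[ v ] (InComp G X v r × (∀ s → InComp G X v s → BranchNbhd t Y (seq s)))
    BranchNbhd⇒InComp {t} {Y} r (rt , ¬rY) =
      let (v , r∈) = ray-InComp X r in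
      X , v , r∈ , λ s s∈ →
        Below-transfer r s (Separates-mono (xs⊆xs++ys _ _) (sep-separates t)) r∈ s∈ rt ,
        All.tabulate λ y∈Y sy → All.lookup ¬rY y∈Y
          (Below-transfer s r (Separates-mono (sep⊆X y∈Y) (sep-separates _)) s∈ r∈ sy)
      where
      X : List Carrier
      X = sep t ++ concatMap sep Y

      sep⊆X : ∀ {y} → y ∈ Y → sep y ⊆ X
      sep⊆X y∈Y z∈sep = ∈-++⁺ʳ (sep t) (∈-concatMap⁺ sep (Any.map (λ { refl → z∈sep }) y∈Y))

    ∁Below⇒eventually-≰ : ∀ (s : Ray G) {y} → ¬ Below (seq s) y → Eventually (λ n → ¬ y ≤ seq s n)
    ∁Below⇒eventually-≰ s {y} ¬sy with ray-eventually-∉ s (y ∷ sep y)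
    ... | m , s∉ =
      m , λ n m≤n y≤sn → ¬sy (tail⇒eventually n λ k →
        separated-path-stays-above (Separates-mono there (sep-separates y))
          (ray-tail-path s n (eventually⇒tail (m , s∉) m≤n) k)
          (y≤sn , λ y≡sn → s∉ n m≤n (here (sym y≡sn))))

    Clear : Carrier → List Carrier → Carrier → Set
    Clear b Y z = b < z × All (λ y → ¬ y ≤ z) Y

    BranchNbhd⇒eventually-Clear : ∀ {b Y} (s : Ray G) → BranchNbhd b Y (seq s) →
                                  Eventually (Clear b Y ∘ seq s)
    BranchNbhd⇒eventually-Clear s (sb , ¬sY) = eventually-× sb (above-none ¬sY)
      where
      above-none : ∀ {Y} → All (∁ (Below (seq s))) Y →
                   Eventually (λ n → All (λ y → ¬ y ≤ seq s n) Y)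
      above-none [] = 0 , λ _ _ → []
      above-none (¬sy ∷ ¬sY) =
        eventually-map (λ (p , ps) → p ∷ ps)
                       (eventually-× (∁Below⇒eventually-≰ s ¬sy) (above-none ¬sY))

    Clear-interval-∉ : ∀ {b Y X z} → Screens b Y X → Clear b Y z → ∀ w → b ≤ w → w ≤ z → w ∉ X
    Clear-interval-∉ screens (_ , Y≰z) w b≤w w≤z w∈X with screens w∈X
    ... | inj₁ b≰w = b≰w b≤w
    ... | inj₂ w∈Y = All.lookup Y≰z w∈Y w≤z

    Clear⇒∉ : ∀ {b Y X z} → Screens b Y X → Clear b Y z → z ∉ X
    Clear⇒∉ screens clear = Clear-interval-∉ screens clear _ (proj₁ (proj₁ clear)) ≤-refl

    Clear⇒path : ∀ {b Y X z} → Screens b Y X → Clear b Y z → Star (EdgeAvoid G X) b z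
    Clear⇒path screens clear = interval-path (proj₁ clear) (Clear-interval-∉ screens clear)

    -- Any two rays in the neighbourhood are joined through b by clear up-paths avoiding X.
    InComp⇒BranchNbhd : ∀ {X v} (r : Ray G) → InComp G X v r →
      ∃[ b ] ∃[ Y ] (BranchNbhd b Y (seq r) × (∀ s → BranchNbhd b Y (seq s) → InComp G X v s))
    InComp⇒BranchNbhd {X} r (n , r∉X , v∉X , v~rn) =
      let (b , Y , r-nbhd , screens) = screen r X
      in b , Y , r-nbhd , λ s s-nbhd →
        let (q , r-clear) = BranchNbhd⇒eventually-Clear r r-nbhd
            (k , s-clear) = BranchNbhd⇒eventually-Clear s s-nbhd
            r-clear-at = r-clear (n + q) (m≤n+m q n)
        in k , (λ i → Clear⇒∉ screens (s-clear (k + i) (m≤m+n k i))) , v∉X ,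
           v~rn ◅◅ ray-tail-path r n r∉X q ◅◅ reverse-avoiding (Clear⇒path screens r-clear-at)
                ◅◅ Clear⇒path screens (s-clear k ≤ℕ-refl)

    Below≐⇒≈ᵉ : ∀ {r s} → Below (seq r) ≐ Below (seq s) → _≈ᵉ_ G r s
    Below≐⇒≈ᵉ {r} {s} r≐s X =
      let (v , r∈) = ray-InComp X r
          (_ , _ , r-nbhd , nbhd⊆) = InComp⇒BranchNbhd r r∈
      in v , r∈ , nbhd⊆ s (BranchNbhd-cong r≐s r-nbhd)

  module _ (T : OrderTree) (G G′ : Graph (OrderTree.Carrier T)) where
    open OrderTreeProperties T
    open Ray using (seq)

    -- Unfolding the constructed rays makes checking the final record prohibitively slow.
    abstract
      transfer : IsTGraph T G → IsTGraph T G′ → Ray G → Ray G′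
      transfer isT isT′ r =
        let (t , t-increasing , _) = TGraph.Below-cofinal-sequence T G isT r
        in proj₁ (TGraph.ray-through T G′ isT′ t t-increasing)

      transfer-preserves-Below : (isT : IsTGraph T G) (isT′ : IsTGraph T G′) →
                                 Below-preserving (transfer isT isT′)
      transfer-preserves-Below isT isT′ r =
        let (t , t-increasing , r≐t) = TGraph.Below-cofinal-sequence T G isT r
        in ≐-trans (proj₂ (TGraph.ray-through T G′ isT′ t t-increasing)) (≐-sym r≐t)

    module _ (isT : IsTGraph T G) (unif : IsUniform T G)
             (isT′ : IsTGraph T G′) (unif′ : IsUniform T G′)
             (φ : Ray G → Ray G′) (φ-preserving : Below-preserving φ) where
      private
        module U = UniformTGraph T G isT unif
        module U′ = UniformTGraph T G′ isT′ unif′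

      Below-preserving⇒cong : ∀ {r s} → _≈ᵉ_ G r s → _≈ᵉ_ G′ (φ r) (φ s)
      Below-preserving⇒cong {r} {s} r≈s =
        U′.Below≐⇒≈ᵉ {φ r} {φ s}
          (≐-trans (φ-preserving r) (≐-trans (U.≈ᵉ⇒Below≐ {r} {s} r≈s) (≐-sym (φ-preserving s))))

      Below-preserving⇒continuous : Continuous G G′ φ
      Below-preserving⇒continuous W (W-respects , W-open) =
        (λ r≈s → W-respects (Below-preserving⇒cong r≈s)) , λ r Wφr →
          let (X , v , φr∈ , component⊆W) = W-open (φ r) Wφr
              (t , Y , φr-nbhd , nbhd⊆component) = U′.InComp⇒BranchNbhd (φ r) φr∈
              (X′ , v′ , r∈ , component⊆nbhd) =
                U.BranchNbhd⇒InComp r (BranchNbhd-cong (φ-preserving r) φr-nbhd)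
          in X′ , v′ , r∈ , λ s s∈ → component⊆W (φ s) (nbhd⊆component (φ s)
               (BranchNbhd-cong (≐-sym (φ-preserving s)) (component⊆nbhd s s∈)))

proposition5p4 : ExcludedMiddle (Level.suc 0ℓ) →
    (T : OrderTree) (G G' : Graph (OrderTree.Carrier T)) →
    IsTGraph T G → IsUniform T G →
    IsTGraph T G' → IsUniform T G' →
    EndsHomeomorphic G G'
proposition5p4 em T G G′ isT unif isT′ unif′ = record
  { to = to
  ; from = from
  ; to-cong = Below-preserving⇒cong T G G′ isT unif isT′ unif′ to to-preserving
  ; from-cong = Below-preserving⇒cong T G′ G isT′ unif′ isT unif from from-preserving
  ; from-to = λ r →
      U.Below≐⇒≈ᵉ {from (to r)} {r} (≐-trans (from-preserving (to r)) (to-preserving r))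
  ; to-from = λ r →
      U′.Below≐⇒≈ᵉ {to (from r)} {r} (≐-trans (to-preserving (from r)) (from-preserving r))
  ; to-cont = Below-preserving⇒continuous T G G′ isT unif isT′ unif′ to to-preserving
  ; from-cont = Below-preserving⇒continuous T G′ G isT′ unif′ isT unif from from-preserving
  }
  where
  open Classical em
  open OrderTreeProperties T using (Below-preserving)
  module U = UniformTGraph T G isT unif
  module U′ = UniformTGraph T G′ isT′ unif′

  to : Ray G → Ray G′
  to = transfer T G G′ isT isT′

  from : Ray G′ → Ray G
  from = transfer T G′ G isT′ isT

  to-preserving : Below-preserving to
  to-preserving = transfer-preserves-Below T G G′ isT isT′

  from-preserving : Below-preserving from
  from-preserving = transfer-preserves-Below T G′ G isT′ isT
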